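{- Let $G=(V,E)$ be a connected finite simple graph and let $u,v\in V$ be adjacent vertices such that $G'=G[V\setminus\{u,v\}]$ is connected. Let $\mathcal{T}'$ be a minimum tree cover of $G'$, and for $a\in V(G')$ let $T_a\in\mathcal{T}'$ denote the tree containing $a$. Suppose there exists $w\in V(G')$ such that (1) $V(T_w)=\{w,x\}$ for some vertex $x$, and (2) there exists $y\in N(w)\cap N(x)$ such that $N(x)\cap V(T_y)=\{y\}$. If $u$ is adjacent to $w$ and $v$ is not adjacent to $w$, then $T(G)\leq T(G')$.
   Context: $N(a)$ denotes the set of neighbors of vertex $a$; $G[S]$ is the subgraph induced by $S$. A tree cover of a graph is a collection of vertex-disjoint simple trees, each an induced subgraph, covering all vertices; $T(\cdot)$ is the minimum size of a tree cover, and a minimum tree cover is one achieving it. -}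

module Defs where

open import Data.Nat using (ℕ; _≤_)
open import Data.Fin using (Fin)
open import Data.List using (List; []; _∷_; _++_; [_]; length)
open import Data.List.Relation.Unary.All using (All)
open import Data.List.Relation.Unary.Unique.Propositional using (Unique)
open import Data.Product using (Σ; ∃; _×_)
open import Data.Empty using (⊥)
open import Relation.Nullary using (¬_; Dec)
open import Relation.Binary.PropositionalEquality using (_≡_)

record Graph (n : ℕ) : Set₁ where
  field
    Adj    : Fin n → Fin n → Set
    sym    : ∀ {a b} → Adj a b → Adj b a
    irrefl : ∀ {a} → ¬ Adj a a
    adj?   : ∀ a b → Dec (Adj a b)

VSet : ℕ → Set₁
VSet n = Fin n → Set

module _ {n : ℕ} (G : Graph n) where
  open Graph G

  data Walk (S : VSet n) : Fin n → Fin n → Set where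
    here : ∀ {a} → S a → Walk S a a
    step : ∀ {a b c} → S a → Adj a b → Walk S b c → Walk S a c

  Connected : VSet n → Set
  Connected S = ∀ a b → S a → S b → Walk S a b

  data Chain : List (Fin n) → Set where
    nil  : Chain []
    one  : ∀ {a} → Chain (a ∷ [])
    cons : ∀ {a b r} → Adj a b → Chain (b ∷ r) → Chain (a ∷ b ∷ r)

  -- x ∷ xs is a cycle of G[S]: at least 3 distinct vertices of S,
  -- consecutive ones adjacent, and the last adjacent to x.
  IsCycle : VSet n → Fin n → List (Fin n) → Set
  IsCycle S x xs =
    2 ≤ length xs × Unique (x ∷ xs) × All S (x ∷ xs) × Chain (x ∷ xs ++ [ x ])

  Acyclic : VSet n → Set
  Acyclic S = ∀ x xs → ¬ IsCycle S x xs

  IsTree : VSet n → Set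
  IsTree S = (∃ λ a → S a) × Connected S × Acyclic S

  Part : {k : ℕ} → VSet n → (Fin n → Fin k) → Fin k → VSet n
  Part S f i a = S a × f a ≡ i

  -- A tree cover of G[S] of size k: a partition of S into k parts
  -- (labels outside S are irrelevant), each inducing a tree.
  record TreeCover (S : VSet n) (k : ℕ) : Set where
    field
      label : Fin n → Fin k
      trees : ∀ i → IsTree (Part S label i)

  IsMinTreeCover : (S : VSet n) (k : ℕ) → TreeCover S k → Set
  IsMinTreeCover S k _ = ∀ k′ → TreeCover S k′ → k ≤ k′

  Full : VSet n
  Full _ = Data.Unit.⊤
    where import Data.Unit

  Minus2 : Fin n → Fin n → VSet n
  Minus2 u v a = ¬ a ≡ u × ¬ a ≡ v

-- Keep every tree of the minimum cover of G′ except T_w = {w, x}. The vertices v, u, w induce a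
-- path (v ≁ w), which replaces T_w, and x, whose only neighbour in T_y is y, joins T_y as a leaf:
-- a tree cover of G with the same number of trees. A leaf never lies on a cycle, since every
-- vertex of a cycle has two distinct neighbours on it.
module Submission where

open import Defs
open import Data.Nat using (ℕ; _≤_; s≤s)
open import Data.Nat.Properties using (≤-refl; +-comm)
open import Data.Fin using (Fin; _≟_)
open import Data.Product using (Σ; ∃₂; _×_; _,_; proj₁; proj₂)
open import Data.Sum as Sum using (_⊎_; inj₁; inj₂)
open import Data.Unit using (tt)
open import Data.Empty using (⊥-elim)
open import Relation.Nullary using (¬_; Dec; yes; no)
open import Relation.Unary using (Decidable; _⊆_; _≐_; _∪_; ｛_｝)
open import Relation.Unary.Properties using (_∪?_)
open import Relation.Binary.PropositionalEquality using (_≡_; _≢_; refl; sym; trans; subst)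
open import Function.Bundles using (_⇔_; Equivalence)
open import Data.List using ([]; _∷_; _++_; [_]; _∷ʳ_; length; initLast; _∷ʳ′_)
open import Data.List.Properties using (++-assoc; length-++)
open import Data.List.Relation.Unary.All as All using (All; []; _∷_)
open import Data.List.Relation.Unary.All.Properties using (∷ʳ⁺; All¬⇒¬Any)
open import Data.List.Relation.Unary.Any using (Any; here; there)
open import Data.List.Membership.Propositional using (_∈_)
open import Data.List.Membership.Propositional.Properties using (∈-∃++; ∈-++⁺ʳ)
open import Data.List.Relation.Unary.AllPairs using ([]; _∷_)
import Data.List.Relation.Unary.Unique.Propositional.Properties as Unique

All-∪⇒All⊎Any : ∀ {A : Set} {P Q : A → Set} {xs} → All (P ∪ Q) xs → All P xs ⊎ Any Q xs
All-∪⇒All⊎Any []             = inj₁ []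
All-∪⇒All⊎Any (inj₁ p ∷ pqs) = Sum.map (p ∷_) there (All-∪⇒All⊎Any pqs)
All-∪⇒All⊎Any (inj₂ q ∷ _)   = inj₂ (here q)

module _ {n : ℕ} (G : Graph n) where
  open Graph G renaming (sym to Adj-sym)

  Chain-∷ʳ : ∀ xs {c d} → Chain G (xs ∷ʳ c) → Adj c d → Chain G (xs ++ c ∷ [ d ])
  Chain-∷ʳ []           one           cd = cons cd one
  Chain-∷ʳ (a ∷ [])     (cons e one)  cd = cons e (cons cd one)
  Chain-∷ʳ (a ∷ b ∷ xs) (cons e ch)   cd = cons e (Chain-∷ʳ (b ∷ xs) ch cd)

  Chain-last : ∀ xs {c d} → Chain G (xs ++ c ∷ [ d ]) → Adj c d
  Chain-last []           (cons cd _) = cd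
  Chain-last (a ∷ [])     (cons _ ch) = Chain-last [] ch
  Chain-last (a ∷ b ∷ xs) (cons _ ch) = Chain-last (b ∷ xs) ch

  IsCycle-rotate₁ : ∀ {S x₀ x₁ xs} → IsCycle G S x₀ (x₁ ∷ xs) → IsCycle G S x₁ (xs ∷ʳ x₀)
  IsCycle-rotate₁ {x₀ = x₀} {x₁ = x₁} {xs = xs} (len , (x₀∉ ∷ uniq) , (s₀ ∷ ss) , cons e ch) =
      subst (2 ≤_) (sym (trans (length-++ xs) (+-comm (length xs) 1))) len
    , Unique.++⁺ uniq ([] ∷ []) (λ { (x₀∈ , here refl) → All¬⇒¬Any x₀∉ x₀∈ })
    , ∷ʳ⁺ ss s₀
    , subst (λ ys → Chain G (x₁ ∷ ys)) (sym (++-assoc xs [ x₀ ] [ x₁ ])) (Chain-∷ʳ (x₁ ∷ xs) ch e)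

  IsCycle-rotate : ∀ ys {S x₀ z zs} → IsCycle G S x₀ (ys ++ z ∷ zs) → IsCycle G S z (zs ++ x₀ ∷ ys)
  IsCycle-rotate []       c = IsCycle-rotate₁ c
  IsCycle-rotate (y ∷ ys) {S} {x₀} {z} {zs} c =
    subst (IsCycle G S z) (++-assoc zs [ x₀ ] (y ∷ ys))
      (IsCycle-rotate ys (subst (IsCycle G S y) (++-assoc ys (z ∷ zs) [ x₀ ]) (IsCycle-rotate₁ c)))

  IsCycle-head-neighbours : ∀ {S z ys} → IsCycle G S z ys →
                            ∃₂ λ a b → a ≢ b × S a × S b × Adj z a × Adj z b
  IsCycle-head-neighbours {z = z} {ys = a ∷ t} c with initLast t | c
  ... | []       | (s≤s () , _)
  ... | m ∷ʳ′ l  | (_ , (_ ∷ a∉ ∷ _) , (_ ∷ sa ∷ ss) , cons za ch) =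
    a , l , All.lookup a∉ l∈ , sa , All.lookup ss l∈ , za , Adj-sym (Chain-last (z ∷ a ∷ m) ch′)
    where
      l∈ : l ∈ m ∷ʳ l
      l∈ = ∈-++⁺ʳ m (here refl)
      ch′ : Chain G ((z ∷ a ∷ m) ++ l ∷ [ z ])
      ch′ = subst (λ t → Chain G (z ∷ a ∷ t)) (++-assoc m [ l ] [ z ]) (cons za ch)

  IsCycle-neighbours : ∀ {S x₀ xs z} → IsCycle G S x₀ xs → z ∈ x₀ ∷ xs →
                       ∃₂ λ a b → a ≢ b × S a × S b × Adj z a × Adj z b
  IsCycle-neighbours c (here refl) = IsCycle-head-neighbours c
  IsCycle-neighbours c (there z∈) with ∈-∃++ z∈
  ... | ys , zs , refl = IsCycle-head-neighbours (IsCycle-rotate ys c)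

  Walk-mono : ∀ {S S′ : VSet n} → S ⊆ S′ → ∀ {a b} → Walk G S a b → Walk G S′ a b
  Walk-mono S⊆S′ (here s)     = here (S⊆S′ s)
  Walk-mono S⊆S′ (step s e w) = step (S⊆S′ s) e (Walk-mono S⊆S′ w)

  Walk-++ : ∀ {S a b c} → Walk G S a b → Walk G S b c → Walk G S a c
  Walk-++ (here _)      w₂ = w₂
  Walk-++ (step s e w₁) w₂ = step s e (Walk-++ w₁ w₂)

  IsTree-resp-≐ : ∀ {S S′ : VSet n} → S ≐ S′ → IsTree G S → IsTree G S′
  IsTree-resp-≐ (S⊆S′ , S′⊆S) ((a , sa) , conn , acyc) =
      (a , S⊆S′ sa)
    , (λ a b sa sb → Walk-mono S⊆S′ (conn a b (S′⊆S sa) (S′⊆S sb)))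
    , (λ x₀ xs (len , uniq , all , ch) → acyc x₀ xs (len , uniq , All.map S′⊆S all , ch))

  IsTree-singleton : ∀ a → IsTree G ｛ a ｝
  IsTree-singleton a = (a , refl) , (λ { _ _ refl refl → here refl }) , acyc
    where
      acyc : Acyclic G ｛ a ｝
      acyc _ []      (() , _)
      acyc _ (_ ∷ _) (_ , ((x₀≢x₁ ∷ _) ∷ _) , (refl ∷ refl ∷ _) , _) = x₀≢x₁ refl

  -- z ∈ S is allowed.
  IsTree-∪-leaf : ∀ {S z p} → IsTree G S → S p → Adj z p → (∀ {a} → S a → Adj z a → a ≡ p) →
                  IsTree G (S ∪ ｛ z ｝)
  IsTree-∪-leaf {S} {z} {p} ((a , sa) , conn , acyc) sp zp onlyNeighbour =
    (a , inj₁ sa) , conn′ , acyc′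
    where
      conn′ : Connected G (S ∪ ｛ z ｝)
      conn′ a b (inj₁ sa)   (inj₁ sb)   = Walk-mono inj₁ (conn a b sa sb)
      conn′ a _ (inj₁ sa)   (inj₂ refl) =
        Walk-++ (Walk-mono inj₁ (conn a p sa sp)) (step (inj₁ sp) (Adj-sym zp) (here (inj₂ refl)))
      conn′ _ b (inj₂ refl) (inj₁ sb)   = step (inj₂ refl) zp (Walk-mono inj₁ (conn p b sp sb))
      conn′ _ _ (inj₂ refl) (inj₂ refl) = here (inj₂ refl)

      onlyNeighbour′ : ∀ {a} → (S ∪ ｛ z ｝) a → Adj z a → a ≡ p
      onlyNeighbour′ (inj₁ sa)   za = onlyNeighbour sa za
      onlyNeighbour′ (inj₂ refl) zz = ⊥-elim (irrefl zz)

      acyc′ : Acyclic G (S ∪ ｛ z ｝)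
      acyc′ x₀ xs c@(len , uniq , all , ch) with All-∪⇒All⊎Any all
      ... | inj₁ allS = acyc x₀ xs (len , uniq , allS , ch)
      ... | inj₂ z∈ with IsCycle-neighbours c z∈
      ...   | a , b , a≢b , sa , sb , za , zb =
        a≢b (trans (onlyNeighbour′ sa za) (sym (onlyNeighbour′ sb zb)))

  IsTree-path₃ : ∀ {a b c} → Adj a b → Adj b c → ¬ Adj c a → IsTree G ((｛ a ｝ ∪ ｛ b ｝) ∪ ｛ c ｝)
  IsTree-path₃ {a} {b} {c} ab bc ¬ca =
    IsTree-∪-leaf (IsTree-∪-leaf (IsTree-singleton a) refl (Adj-sym ab) (λ a≡ _ → sym a≡))
                  (inj₂ refl) (Adj-sym bc) onlyNeighbour
    where
      onlyNeighbour : ∀ {d} → (｛ a ｝ ∪ ｛ b ｝) d → Adj c d → d ≡ b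
      onlyNeighbour (inj₁ refl) ca = ⊥-elim (¬ca ca)
      onlyNeighbour (inj₂ b≡d)  _  = sym b≡d

module Relabelling {n k : ℕ} (G : Graph n) (u v w x y : Fin n) (label : Fin n → Fin k) where
  open Graph G using (Adj)

  Old : Fin k → VSet n
  Old = Part G (Minus2 G u v) label

  Joined : VSet n
  Joined = (｛ w ｝ ∪ ｛ u ｝) ∪ ｛ v ｝

  joined? : Decidable Joined
  joined? = ((w ≟_) ∪? (u ≟_)) ∪? (v ≟_)

  data Role (a : Fin n) : Fin k → Set where
    joined : Joined a → Role a (label w)
    moved  : ¬ Joined a → x ≡ a → Role a (label y)
    kept   : ¬ Joined a → x ≢ a → Role a (label a)

  newLabel : ∀ a → Dec (Joined a) → Dec (x ≡ a) → Fin k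
  newLabel a (yes _) _       = label w
  newLabel a (no _)  (yes _) = label y
  newLabel a (no _)  (no _)  = label a

  newRole : ∀ a j? x? → Role a (newLabel a j? x?)
  newRole a (yes j)  _        = joined j
  newRole a (no ¬j)  (yes xa) = moved ¬j xa
  newRole a (no ¬j)  (no ¬xa) = kept ¬j ¬xa

  relabel : Fin n → Fin k
  relabel a = newLabel a (joined? a) (x ≟ a)

  role : ∀ a → Role a (relabel a)
  role a = newRole a (joined? a) (x ≟ a)

  New : Fin k → VSet n
  New = Part G (Full G) relabel

  ¬Joined⇒Minus2 : ∀ {a} → ¬ Joined a → Minus2 G u v a
  ¬Joined⇒Minus2 ¬j = (λ a≡u → ¬j (inj₁ (inj₂ (sym a≡u)))) , (λ a≡v → ¬j (inj₂ (sym a≡v)))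

  Joined∩Minus2⇒w : ∀ {a} → Minus2 G u v a → Joined a → w ≡ a
  Joined∩Minus2⇒w _         (inj₁ (inj₁ w≡a)) = w≡a
  Joined∩Minus2⇒w (a≢u , _) (inj₁ (inj₂ u≡a)) = ⊥-elim (a≢u (sym u≡a))
  Joined∩Minus2⇒w (_ , a≢v) (inj₂ v≡a)        = ⊥-elim (a≢v (sym v≡a))

  module _ (x∈G′ : Minus2 G u v x) (label-x : label x ≡ label w) (ly≢lw : label y ≢ label w)
           (Old-w : ∀ {a} → Old (label w) a → a ≡ w ⊎ a ≡ x) where

    Old⊆New : ∀ {i} → i ≢ label w → Old i ⊆ New i
    Old⊆New {i} i≢lw {a} (a∈G′ , refl) with relabel a | role a
    ... | _ | joined j with Joined∩Minus2⇒w a∈G′ j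
    ...   | refl = ⊥-elim (i≢lw refl)
    Old⊆New {i} i≢lw {a} (a∈G′ , refl) | _ | moved _ refl = ⊥-elim (i≢lw label-x)
    Old⊆New {i} i≢lw {a} (a∈G′ , refl) | _ | kept _ _ = tt , refl

    New⊆Old : ∀ {i} → i ≢ label w → i ≢ label y → New i ⊆ Old i
    New⊆Old {i} i≢lw i≢ly {a} (_ , refl) with relabel a | role a
    ... | _ | joined _    = ⊥-elim (i≢lw refl)
    ... | _ | moved _ _   = ⊥-elim (i≢ly refl)
    ... | _ | kept ¬j _   = ¬Joined⇒Minus2 ¬j , refl

    New-y⊆Old∪x : New (label y) ⊆ Old (label y) ∪ ｛ x ｝
    New-y⊆Old∪x {a} (_ , r≡ly) with relabel a | role a
    ... | _ | joined _    = ⊥-elim (ly≢lw (sym r≡ly))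
    ... | _ | moved _ x≡a = inj₂ x≡a
    ... | _ | kept ¬j _   = inj₁ (¬Joined⇒Minus2 ¬j , r≡ly)

    New-y⊆Old : x ≡ w → New (label y) ⊆ Old (label y)
    New-y⊆Old x≡w {a} (_ , r≡ly) with relabel a | role a
    ... | _ | joined _    = ⊥-elim (ly≢lw (sym r≡ly))
    ... | _ | moved ¬j x≡a = ⊥-elim (¬j (inj₁ (inj₁ (trans (sym x≡w) x≡a))))
    ... | _ | kept ¬j _   = ¬Joined⇒Minus2 ¬j , r≡ly

    x∈New-y : x ≢ w → New (label y) x
    x∈New-y x≢w with relabel x | role x
    ... | _ | joined j    = ⊥-elim (x≢w (sym (Joined∩Minus2⇒w x∈G′ j)))
    ... | _ | moved _ _   = tt , refl
    ... | _ | kept _ x≢x  = ⊥-elim (x≢x refl)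

    Joined≐New-w : Joined ≐ New (label w)
    Joined≐New-w = joined⊆new , new⊆joined
      where
        new⊆joined : New (label w) ⊆ Joined
        new⊆joined {a} (_ , r≡lw) with relabel a | role a
        ... | _ | joined j    = j
        ... | _ | moved _ _   = ⊥-elim (ly≢lw r≡lw)
        ... | _ | kept ¬j x≢a with Old-w (¬Joined⇒Minus2 ¬j , r≡lw)
        ...   | inj₁ a≡w = ⊥-elim (¬j (inj₁ (inj₁ (sym a≡w))))
        ...   | inj₂ a≡x = ⊥-elim (x≢a (sym a≡x))

        joined⊆new : Joined ⊆ New (label w)
        joined⊆new {a} j with relabel a | role a
        ... | _ | joined _    = tt , refl
        ... | _ | moved ¬j _  = ⊥-elim (¬j j)
        ... | _ | kept ¬j _   = ⊥-elim (¬j j)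

    relabel-isTree : (∀ i → IsTree G (Old i)) →
                     Adj w u → Adj u v → ¬ Adj v w →
                     Adj x y → Old (label y) y → (∀ {a} → Old (label y) a → Adj x a → a ≡ y) →
                     ∀ i → IsTree G (New i)
    relabel-isTree trees wu uv ¬vw xy y∈ onlyNeighbour i with i ≟ label w | i ≟ label y
    ... | yes refl | _        = IsTree-resp-≐ G Joined≐New-w (IsTree-path₃ G wu uv ¬vw)
    ... | no i≢lw  | no i≢ly  = IsTree-resp-≐ G (Old⊆New i≢lw , New⊆Old i≢lw i≢ly) (trees i)
    ... | no _     | yes refl with x ≟ w
    -- x ≡ w is the degenerate case T_w = {w}, where T_y is unchanged.
    ...   | yes x≡w = IsTree-resp-≐ G (Old⊆New ly≢lw , New-y⊆Old x≡w) (trees (label y))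
    ...   | no x≢w  = IsTree-resp-≐ G (Sum.[ Old⊆New ly≢lw , (λ { refl → x∈New-y x≢w }) ] , New-y⊆Old∪x)
                        (IsTree-∪-leaf G (trees (label y)) y∈ xy onlyNeighbour)

mainTheorem17 : (n : ℕ) (G : Graph n) (u v : Fin n)
    → Connected G (Full G)
    → Graph.Adj G u v
    → Connected G (Minus2 G u v)
    → (k : ℕ) (C : TreeCover G (Minus2 G u v) k)
    → IsMinTreeCover G (Minus2 G u v) k C
    → (w x : Fin n)
    → Minus2 G u v w
    → (∀ a → Part G (Minus2 G u v) (TreeCover.label C) (TreeCover.label C w) a ⇔ (a ≡ w ⊎ a ≡ x))
    → (Σ (Fin n) λ y → Graph.Adj G w y × Graph.Adj G x y
    × (∀ a → (Graph.Adj G x a × Part G (Minus2 G u v) (TreeCover.label C) (TreeCover.label C y) a) ⇔ a ≡ y))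
    → Graph.Adj G u w
    → ¬ Graph.Adj G v w
    → Σ ℕ λ k′ → TreeCover G (Full G) k′ × k′ ≤ k
mainTheorem17 n G u v _ uv _ k C _ w x _ T-w (y , wy , xy , T-y) uw ¬vw =
  k , record { label = relabel ; trees = trees } , ≤-refl
  where
    open Graph G using (irrefl) renaming (sym to Adj-sym)
    open TreeCover C using (label)
    open Relabelling G u v w x y label
    open Equivalence

    x∈Old-w : Old (label w) x
    x∈Old-w = from (T-w x) (inj₂ refl)

    y∈Old-y : Old (label y) y
    y∈Old-y = proj₂ (from (T-y y) refl)

    ly≢lw : label y ≢ label w
    ly≢lw ly≡lw with to (T-w y) (proj₁ y∈Old-y , ly≡lw)
    ... | inj₁ refl = irrefl wy
    ... | inj₂ refl = irrefl xy

    trees : ∀ i → IsTree G (New i)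
    trees = relabel-isTree (proj₁ x∈Old-w) (proj₂ x∈Old-w) ly≢lw (to (T-w _))
              (TreeCover.trees C) (Adj-sym uw) uv ¬vw xy y∈Old-y (λ s xa → to (T-y _) (xa , s))
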